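{- Let $\Phi\in\{B_n,C_n,D_n\}$, $\mathbf s\in{\rm Score}(\Phi)$, and suppose there is a path of length two between $\mathcal T_1,\mathcal T_2$ in ${\rm IntGr}(\Phi,\mathbf s)$ passing through $\mathcal T_{12}$, with copies of generators $\mathcal G_1,\mathcal G_2\subseteq\mathcal T_{12}$ such that $\mathcal T_i=\mathcal T_{12}*\mathcal G_i$, and suppose $\mathcal G_1,\mathcal G_2$ are adjacent (have exactly one game in common). Let $\mathcal D=\mathcal T_1\setminus\mathcal T_2$. Then: (1) if $\mathcal G_1,\mathcal G_2$ are neutral triangles whose union spans four (resp. three) vertices, then $\pi(\mathcal D)$ is a square (resp. tent); (2) if $\mathcal G_1,\mathcal G_2$ are neutral clovers, then $\pi(\mathcal D)$ is a tent; (3) if $\mathcal G_1$ is a neutral pair and $\mathcal G_2$ is a neutral pair or a neutral triangle, then $\pi(\mathcal D)$ is a fork; (4) if $\mathcal G_1$ is a neutral clover and $\mathcal G_2$ is a neutral triangle, then $\pi(\mathcal D)$ is a hanger.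
   Context: Vectors: $\mathbf e^{\pm}_{ij}=\mathbf e_i\pm\mathbf e_j$ ($i>j$), $\mathbf e^h_i=\mathbf e_i$, $\mathbf e^\ell_i=2\mathbf e_i$ for negative edges $e^-_{ij}$, positive edges $e^+_{ij}$, half edges $e^h_i$, loops $e^\ell_i$. $\mathcal K_{D_n}$: all negative and positive edges on $[n]$; $\mathcal K_{B_n}$: these plus all half edges; $\mathcal K_{C_n}$: all negative and positive edges plus all loops. A Coxeter tournament on $\mathcal K_\Phi$ is $(w_e)$, $w_e\in\{0,1\}$, over its edges (games); score $\sum_e(w_e-\frac12)\mathbf e$; a sub-tournament (subset of games) is neutral if this sum over its games is $\mathbf 0$; $\mathcal T*\mathcal X$ flips outcomes of the games of $\mathcal X$. ${\rm Score}(\Phi)$ = set of score sequences of tournaments on $\mathcal K_\Phi$. A copy of a type-$\Phi$ generator is a neutral sub-tournament whose games are: (a) neutral triangle (all types): three negative edges pairwise joining three distinct vertices, or one negative and two positive edges pairwise joining three distinct vertices; (b) neutral pair (only $B_n$): a negative or positive edge between $i\ne j$ plus $e^h_i,e^h_j$; (c) neutral clover (only $C_n$): $e^-_{ij},e^+_{ij},e^\ell_i$. ${\rm IntGr}(\Phi,\mathbf s)$: multigraph on tournaments on $\mathcal K_\Phi$ with score $\mathbf s$, $\mathcal T_1,\mathcal T_2$ joined iff $\mathcal T_2=\mathcal T_1*\mathcal G$ for a generator copy $\mathcal G\subseteq\mathcal T_1$ (double edge if $\mathcal G$ is a clover, single otherwise). $\mathcal T_1\setminus\mathcal T_2$ is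 the sub-tournament of $\mathcal T_1$ consisting of the games whose outcomes differ in $\mathcal T_1$ and $\mathcal T_2$. The projection graph $\pi(\mathcal D)$ is the undirected multigraph (with half edges and loops allowed) obtained by forgetting outcomes: each negative/positive edge becomes an undirected edge, each half edge an undirected half edge, each loop an undirected loop. Shapes: square = a $4$-cycle on four distinct vertices; tent = three vertices $x,y,z$ with two parallel edges between $x,y$ and two parallel edges between $x,z$; fork = three vertices $x,y,z$ with edges $xy$, $xz$ and half edges at $y$ and at $z$; hanger = a triangle on $x,y,z$ together with a loop at $x$. -}

module Defs where

open import Data.Nat as ℕ using (ℕ)
open import Data.Fin as Fin using (Fin; toℕ; _≟_)
open import Data.Bool using (Bool; true; false; not; if_then_else_)
open import Data.Integer as ℤ using (ℤ; +_; -_)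
open import Data.List using (List; []; _∷_; map; length)
open import Data.List.Membership.Propositional using (_∈_)
open import Data.List.Relation.Unary.Unique.Propositional using (Unique)
open import Data.List.Relation.Binary.Permutation.Propositional using (_↭_)
open import Data.Product using (Σ; ∃; _×_; _,_)
open import Data.Sum using (_⊎_)
open import Relation.Nullary using (¬_; does)
open import Relation.Binary.PropositionalEquality using (_≡_; _≢_)

data RootSys : Set where
  B C D : RootSys

-- Games (edges).  neg i j = e^-_{ij}, pos i j = e^+_{ij} (meaningful for
-- j < i), half i = e^h_i, loop i = e^ℓ_i.  Vertex set [n] = Fin n.

data Game (n : ℕ) : Set where
  neg pos : Fin n → Fin n → Game n
  half loop : Fin n → Game n

Valid : {n : ℕ} → RootSys → Game n → Set
Valid Φ (neg i j) = j Fin.< i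
Valid Φ (pos i j) = j Fin.< i
Valid Φ (half i)  = Φ ≡ B
Valid Φ (loop i)  = Φ ≡ C

-- A tournament on K_Φ: an outcome w_e ∈ {0,1} (false/true) for every game;
-- values on games not in K_Φ are irrelevant (never used).
Tournament : ℕ → Set
Tournament n = Game n → Bool

unit : {n : ℕ} → Fin n → Fin n → ℤ
unit i k = if does (i ≟ k) then + 1 else + 0

vec : {n : ℕ} → Game n → Fin n → ℤ
vec (neg i j) k = unit i k ℤ.- unit j k
vec (pos i j) k = unit i k ℤ.+ unit j k
vec (half i)  k = unit i k
vec (loop i)  k = + 2 ℤ.* unit i k

-- 2(w - 1/2) ∈ {-1, +1}
sgn : Bool → ℤ
sgn true  = + 1
sgn false = - (+ 1)

-- twice the score contribution (w_g - 1/2) g of game g in T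
contrib : {n : ℕ} → Tournament n → Game n → Fin n → ℤ
contrib T g k = sgn (T g) ℤ.* vec g k

Neutral3 : {n : ℕ} → Tournament n → Game n → Game n → Game n → Set
Neutral3 T a b c = ∀ k → contrib T a k ℤ.+ contrib T b k ℤ.+ contrib T c k ≡ + 0

data Kind : Set where
  triangle pair clover : Kind

data IsGen {n : ℕ} (Φ : RootSys) : Kind → Game n → Game n → Game n → Set where
  tri-nnn : ∀ {x y z} → z Fin.< y → y Fin.< x →
            IsGen Φ triangle (neg x y) (neg x z) (neg y z)
  tri-npp : ∀ {x y z} → z Fin.< y → y Fin.< x →
            IsGen Φ triangle (neg x y) (pos x z) (pos y z)
  tri-pnp : ∀ {x y z} → z Fin.< y → y Fin.< x →
            IsGen Φ triangle (pos x y) (neg x z) (pos y z)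
  tri-ppn : ∀ {x y z} → z Fin.< y → y Fin.< x →
            IsGen Φ triangle (pos x y) (pos x z) (neg y z)
  pair-n : ∀ {i j} → Φ ≡ B → j Fin.< i →
           IsGen Φ pair (neg i j) (half i) (half j)
  pair-p : ∀ {i j} → Φ ≡ B → j Fin.< i →
           IsGen Φ pair (pos i j) (half i) (half j)
  clover : ∀ {i j} → Φ ≡ C → j Fin.< i →
           IsGen Φ clover (neg i j) (pos i j) (loop i)

record GenCopy {n : ℕ} (Φ : RootSys) (T : Tournament n) : Set where
  constructor gencopy
  field
    kind    : Kind
    ga gb gc : Game n
    isGen   : IsGen Φ kind ga gb gc
    neutral : Neutral3 T ga gb gc
open GenCopy public

_∈G_ : {n : ℕ} {Φ : RootSys} {T : Tournament n} → Game n → GenCopy Φ T → Set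
g ∈G G = g ≡ ga G ⊎ g ≡ gb G ⊎ g ≡ gc G

IsFlip : {n : ℕ} (Φ : RootSys) (T : Tournament n) → GenCopy Φ T → Tournament n → Set
IsFlip Φ T G T' = ∀ g → Valid Φ g →
  (g ∈G G → T' g ≡ not (T g)) × (¬ (g ∈G G) → T' g ≡ T g)

Adjacent : {n : ℕ} {Φ : RootSys} {T : Tournament n} → GenCopy Φ T → GenCopy Φ T → Set
Adjacent {n} G1 G2 = Σ (Game n) λ g → g ∈G G1 × g ∈G G2 ×
  (∀ h → h ∈G G1 → h ∈G G2 → h ≡ g)

Incident : {n : ℕ} → Game n → Fin n → Set
Incident (neg i j) v = v ≡ i ⊎ v ≡ j
Incident (pos i j) v = v ≡ i ⊎ v ≡ j
Incident (half i)  v = v ≡ i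
Incident (loop i)  v = v ≡ i

SpansVertices : {n : ℕ} {Φ : RootSys} {T : Tournament n} →
                ℕ → GenCopy Φ T → GenCopy Φ T → Set
SpansVertices {n} k G1 G2 = Σ (List (Fin n)) λ L → length L ≡ k × Unique L ×
  (∀ v → (v ∈ L → Σ (Game n) λ g → (g ∈G G1 ⊎ g ∈G G2) × Incident g v)
       × (Σ (Game n) (λ g → (g ∈G G1 ⊎ g ∈G G2) × Incident g v) → v ∈ L))

InDiff : {n : ℕ} → RootSys → Tournament n → Tournament n → Game n → Set
InDiff Φ T1 T2 g = Valid Φ g × T1 g ≢ T2 g

-- undirected multigraph elements; uedge i j is meant with j < i
data UEdge (n : ℕ) : Set where
  uedge : Fin n → Fin n → UEdge n
  uhalf uloop : Fin n → UEdge n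

-- undirected edge between a and b (normalised: larger endpoint first)
ue : {n : ℕ} → Fin n → Fin n → UEdge n
ue a b = if does (toℕ a ℕ.<? toℕ b) then uedge b a else uedge a b

proj : {n : ℕ} → Game n → UEdge n
proj (neg i j) = uedge i j
proj (pos i j) = uedge i j
proj (half i)  = uhalf i
proj (loop i)  = uloop i

-- π(D) equals the multigraph given by the list S of undirected elements
ProjIs : {n : ℕ} → (Game n → Set) → List (UEdge n) → Set
ProjIs {n} Δ S = Σ (List (Game n)) λ L → Unique L ×
  (∀ g → (g ∈ L → Δ g) × (Δ g → g ∈ L)) × (map proj L ↭ S)

Square : {n : ℕ} → (Game n → Set) → Set
Square {n} Δ = Σ (Fin n) λ a → Σ (Fin n) λ b → Σ (Fin n) λ c → Σ (Fin n) λ d →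
  a ≢ b × a ≢ c × a ≢ d × b ≢ c × b ≢ d × c ≢ d ×
  ProjIs Δ (ue a b ∷ ue b c ∷ ue c d ∷ ue d a ∷ [])

Tent : {n : ℕ} → (Game n → Set) → Set
Tent {n} Δ = Σ (Fin n) λ x → Σ (Fin n) λ y → Σ (Fin n) λ z →
  x ≢ y × x ≢ z × y ≢ z ×
  ProjIs Δ (ue x y ∷ ue x y ∷ ue x z ∷ ue x z ∷ [])

Fork : {n : ℕ} → (Game n → Set) → Set
Fork {n} Δ = Σ (Fin n) λ x → Σ (Fin n) λ y → Σ (Fin n) λ z →
  x ≢ y × x ≢ z × y ≢ z ×
  ProjIs Δ (ue x y ∷ ue x z ∷ uhalf y ∷ uhalf z ∷ [])

Hanger : {n : ℕ} → (Game n → Set) → Set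
Hanger {n} Δ = Σ (Fin n) λ x → Σ (Fin n) λ y → Σ (Fin n) λ z →
  x ≢ y × x ≢ z × y ≢ z ×
  ProjIs Δ (ue x y ∷ ue y z ∷ ue x z ∷ uloop x ∷ [])

-- T₁ = T₁₂ * G₁ and T₂ = T₁₂ * G₂ differ exactly on the games lying in one of G₁, G₂
-- but not in both. Since G₁ and G₂ share exactly one game g, D consists of the two
-- other games of G₁ and the two other games of G₂, so π(D) is read off by looking at
-- each generator from g: a triangle at its edge uv leaves the edges uw, vw; a pair
-- leaves uw and the half edge at w when g is the half edge at u, and the half edges
-- at u, v when g is its edge uv; a clover leaves the two parallel edges uv when g is
-- the loop at u, and the other edge uv with the loop at u when g is an edge.
-- Adjacency excludes the remaining combinations, and for two triangles on the edge
-- uv the number of spanned vertices tells whether the apexes coincide (tent) or not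
-- (square).
module Submission where

open import Defs
open import Data.Nat using (ℕ)
open import Data.Product using (_×_; Σ; _,_; proj₁; proj₂)
open import Data.Sum using (_⊎_; inj₁; inj₂; [_,_]; [_,_]′; swap)
open import Relation.Binary.PropositionalEquality using (_≡_; _≢_; refl; sym; trans; cong; ≢-sym)

import Data.Nat as ℕ
import Data.Nat.Properties as ℕ
open import Data.Bool using (true; false)
open import Data.Bool.Properties using (not-¬)
open import Data.Empty using (⊥-elim)
open import Data.Fin using (Fin; toℕ; _<_)
open import Data.Fin.Properties using (<-trans; <⇒≢; <-cmp) renaming (_≟_ to _≟ᶠ_)
open import Data.List using (List; []; _∷_; _++_; length)
open import Data.List.Membership.Propositional using (_∈_)
open import Data.List.Membership.Propositional.Properties using (∈-++⁻; ∈-++⁺ˡ; ∈-++⁺ʳ)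
open import Data.List.Membership.Propositional.Properties.WithK using (unique∧set⇒bag)
open import Data.List.Relation.Binary.BagAndSetEquality using (∼bag⇒↭)
open import Data.List.Relation.Binary.Permutation.Propositional using (_↭_; ↭-refl; ↭-prep; ↭-swap)
open import Data.List.Relation.Binary.Permutation.Propositional.Properties
  using (↭-length; ++-comm; ↭-reverse)
open import Data.List.Relation.Unary.All using ([]; _∷_)
open import Data.List.Relation.Unary.AllPairs using ([]; _∷_)
open import Data.List.Relation.Unary.Any using (here; there)
open import Data.List.Relation.Unary.Unique.Propositional using (Unique)
open import Data.List.Relation.Unary.Unique.Propositional.Properties using (++⁺)
open import Data.Product.Properties using () renaming (≡-dec to ×-≡-dec)
open import Data.Sum.Properties using () renaming (≡-dec to ⊎-≡-dec)
open import Function using (id; _∘_)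
open import Function.Bundles using (_⇔_; mk⇔; Equivalence)
open import Relation.Binary.Definitions using (DecidableEquality; tri<; tri≈; tri>)
open import Relation.Nullary using (¬_; Dec; yes; no; does; contradiction)
open import Relation.Nullary.Decidable using (map′; _⊎-dec_; dec-true; dec-false)

open Equivalence using (to; from)

private
  variable
    n : ℕ
    Φ : RootSys
    T T₁ T₂ : Tournament n
    A : Set
    a b c g h : A
    i j t : Fin n

_≟ᴳ_ : DecidableEquality (Game n)
_≟ᴳ_ {n} g h = map′ (encode-injective g h) (cong encode) (encode g ≟ᶜ encode h)
  where
  Code : Set
  Code = (Fin n × Fin n) ⊎ (Fin n × Fin n) ⊎ Fin n ⊎ Fin n

  _≟ᶜ_ : DecidableEquality Code
  _≟ᶜ_ = ⊎-≡-dec pair-dec (⊎-≡-dec pair-dec (⊎-≡-dec _≟ᶠ_ _≟ᶠ_))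
    where pair-dec = ×-≡-dec _≟ᶠ_ _≟ᶠ_

  encode : Game n → Code
  encode (neg i j) = inj₁ (i , j)
  encode (pos i j) = inj₂ (inj₁ (i , j))
  encode (half i)  = inj₂ (inj₂ (inj₁ i))
  encode (loop i)  = inj₂ (inj₂ (inj₂ i))

  decode : Code → Game n
  decode (inj₁ (i , j))         = neg i j
  decode (inj₂ (inj₁ (i , j)))  = pos i j
  decode (inj₂ (inj₂ (inj₁ i))) = half i
  decode (inj₂ (inj₂ (inj₂ i))) = loop i

  decode-encode : ∀ g → decode (encode g) ≡ g
  decode-encode (neg i j) = refl
  decode-encode (pos i j) = refl
  decode-encode (half i)  = refl
  decode-encode (loop i)  = refl

  encode-injective : ∀ g h → encode g ≡ encode h → g ≡ h
  encode-injective g h e =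
    trans (sym (decode-encode g)) (trans (cong decode e) (decode-encode h))

ue-cases : (a b : Fin n) → ue a b ≡ uedge a b ⊎ ue a b ≡ uedge b a
ue-cases a b with does (toℕ a ℕ.<? toℕ b)
... | true  = inj₂ refl
... | false = inj₁ refl

ue-ordered : j < i → ue i j ≡ uedge i j
ue-ordered {j = j} {i = i} j<i
  rewrite dec-false (toℕ i ℕ.<? toℕ j) (ℕ.<-asym j<i) = refl

ue-reversed : j < i → ue j i ≡ uedge i j
ue-reversed {j = j} {i = i} j<i
  rewrite dec-true (toℕ j ℕ.<? toℕ i) j<i = refl

ue-comm : (a b : Fin n) → ue a b ≡ ue b a
ue-comm a b with <-cmp a b
... | tri< a<b _ _ = trans (ue-reversed a<b) (sym (ue-ordered a<b))
... | tri≈ _ refl _ = refl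
... | tri> _ _ b<a = trans (ue-ordered b<a) (sym (ue-reversed b<a))

uedge-injective : {a b c d : Fin n} → uedge a b ≡ uedge c d → a ≡ c × b ≡ d
uedge-injective refl = refl , refl

incident-uedge : {a b : Fin n} → proj h ≡ uedge a b → Incident h t ⇔ (t ≡ a ⊎ t ≡ b)
incident-uedge {h = neg _ _} refl = mk⇔ id id
incident-uedge {h = pos _ _} refl = mk⇔ id id

incident-ue : {a b : Fin n} → proj h ≡ ue a b → Incident h t ⇔ (t ≡ a ⊎ t ≡ b)
incident-ue {a = a} {b} e with ue-cases a b
... | inj₁ ab = incident-uedge (trans e ab)
... | inj₂ ba = let ends = incident-uedge (trans e ba) in mk⇔ (swap ∘ to ends) (from ends ∘ swap)

-- h ∈G G unfolds to In₃ h (ga G) (gb G) (gc G), so the views below apply to generator copies.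
In₃ : A → A → A → A → Set
In₃ h a b c = h ≡ a ⊎ h ≡ b ⊎ h ≡ c

Distinct : A → A → A → Set
Distinct a b c = a ≢ b × a ≢ c × b ≢ c

record Split (a b c g : A) : Set where
  field
    rest₁ rest₂ : A
    members  : In₃ h a b c ⇔ In₃ h g rest₁ rest₂
    distinct : Distinct g rest₁ rest₂

  rests : List A
  rests = rest₁ ∷ rest₂ ∷ []

  self-∈ : In₃ g a b c
  self-∈ = from members (inj₁ refl)

  ∈-rests⇒ : h ∈ rests → In₃ h a b c × h ≢ g
  ∈-rests⇒ (here refl)         = from members (inj₂ (inj₁ refl)) , ≢-sym (proj₁ distinct)
  ∈-rests⇒ (there (here refl)) = from members (inj₂ (inj₂ refl)) , ≢-sym (proj₁ (proj₂ distinct))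

  ⇒∈-rests : In₃ h a b c → h ≢ g → h ∈ rests
  ⇒∈-rests m h≢g with to members m
  ... | inj₁ h≡g         = ⊥-elim (h≢g h≡g)
  ... | inj₂ (inj₁ refl) = here refl
  ... | inj₂ (inj₂ refl) = there (here refl)

  rests-unique : Unique rests
  rests-unique = (proj₂ (proj₂ distinct) ∷ []) ∷ [] ∷ []

open Split

private
  in₃-swap : In₃ h a b c → In₃ h b a c
  in₃-swap (inj₁ e)        = inj₂ (inj₁ e)
  in₃-swap (inj₂ (inj₁ e)) = inj₁ e
  in₃-swap (inj₂ (inj₂ e)) = inj₂ (inj₂ e)

  in₃-rotate : In₃ h a b c → In₃ h c a b
  in₃-rotate (inj₁ e)        = inj₂ (inj₁ e)
  in₃-rotate (inj₂ (inj₁ e)) = inj₂ (inj₂ e)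
  in₃-rotate (inj₂ (inj₂ e)) = inj₁ e

  in₃-unrotate : In₃ h c a b → In₃ h a b c
  in₃-unrotate (inj₁ e)        = inj₂ (inj₂ e)
  in₃-unrotate (inj₂ (inj₁ e)) = inj₁ e
  in₃-unrotate (inj₂ (inj₂ e)) = inj₂ (inj₁ e)

split : Distinct a b c → In₃ g a b c → Split a b c g
split {b = b} {c = c} d (inj₁ refl) =
  record { rest₁ = b ; rest₂ = c ; members = mk⇔ id id ; distinct = d }
split {a = a} {c = c} (a≢b , a≢c , b≢c) (inj₂ (inj₁ refl)) =
  record { rest₁ = a ; rest₂ = c ; members = mk⇔ in₃-swap in₃-swap
         ; distinct = ≢-sym a≢b , b≢c , a≢c }
split {a = a} {b = b} (a≢b , a≢c , b≢c) (inj₂ (inj₂ refl)) =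
  record { rest₁ = a ; rest₂ = b ; members = mk⇔ in₃-rotate in₃-unrotate
         ; distinct = ≢-sym a≢c , ≢-sym b≢c , a≢b }

record TriangleView (a b c g : Game n) : Set where
  constructor triangleAt
  field
    S          : Split a b c g
    u v w      : Fin n
    v<u        : v < u
    w≢u        : w ≢ u
    w≢v        : w ≢ v
    proj-g     : proj g ≡ uedge u v
    proj-rest₁ : proj (rest₁ S) ≡ ue u w
    proj-rest₂ : proj (rest₂ S) ≡ ue v w

  distinct-uvw : Distinct u v w
  distinct-uvw = ≢-sym (<⇒≢ v<u) , ≢-sym w≢u , ≢-sym w≢v

  vertices⇔ : Σ (Game n) (λ h → In₃ h a b c × Incident h t) ⇔ t ∈ u ∷ v ∷ w ∷ []
  vertices⇔ = mk⇔ vertex-of vertex-at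
    where
    vertex-of : Σ (Game n) (λ h → In₃ h a b c × Incident h t) → t ∈ u ∷ v ∷ w ∷ []
    vertex-of (h , m , inc) with to (members S) m
    ... | inj₁ refl        = [ here , there ∘ here ]′ (to (incident-uedge proj-g) inc)
    ... | inj₂ (inj₁ refl) = [ here , there ∘ there ∘ here ]′ (to (incident-ue proj-rest₁) inc)
    ... | inj₂ (inj₂ refl) =
      [ there ∘ here , there ∘ there ∘ here ]′ (to (incident-ue proj-rest₂) inc)

    vertex-at : t ∈ u ∷ v ∷ w ∷ [] → Σ (Game n) (λ h → In₃ h a b c × Incident h t)
    vertex-at (here refl)                 = g , self-∈ S , from (incident-uedge proj-g) (inj₁ refl)
    vertex-at (there (here refl))         = g , self-∈ S , from (incident-uedge proj-g) (inj₂ refl)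
    vertex-at (there (there (here refl))) =
      rest₁ S , from (members S) (inj₂ (inj₁ refl)) , from (incident-ue proj-rest₁) (inj₂ refl)

open TriangleView using (distinct-uvw; vertices⇔)

same-uedge : {a b : Game n} {i j k l : Fin n} →
             a ≡ b → proj a ≡ uedge i j → proj b ≡ uedge k l → i ≡ k × j ≡ l
same-uedge refl pa pb = uedge-injective (trans (sym pa) pb)

triangleView-shape : {x y z : Fin n} → z < y → y < x →
                     proj a ≡ uedge x y → proj b ≡ uedge x z → proj c ≡ uedge y z →
                     In₃ g a b c → TriangleView a b c g
triangleView-shape {a = a} {b = b} {c = c} {x = x} {y = y} {z = z} z<y y<x pa pb pc = view
  where
  z<x : z < x
  z<x = <-trans z<y y<x
  abc : Distinct a b c
  abc = (λ e → <⇒≢ z<y (sym (proj₂ (same-uedge e pa pb))))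
      , (λ e → <⇒≢ y<x (sym (proj₁ (same-uedge e pa pc))))
      , (λ e → <⇒≢ y<x (sym (proj₁ (same-uedge e pb pc))))
  view : In₃ g a b c → TriangleView a b c g
  view m@(inj₁ refl) =
    triangleAt (split abc m) x y z y<x (<⇒≢ z<x) (<⇒≢ z<y)
    pa (trans pb (sym (ue-ordered z<x))) (trans pc (sym (ue-ordered z<y)))
  view m@(inj₂ (inj₁ refl)) =
    triangleAt (split abc m) x z y z<x (<⇒≢ y<x) (≢-sym (<⇒≢ z<y))
    pb (trans pa (sym (ue-ordered y<x))) (trans pc (sym (ue-reversed z<y)))
  view m@(inj₂ (inj₂ refl)) =
    triangleAt (split abc m) y z x z<y (≢-sym (<⇒≢ y<x)) (≢-sym (<⇒≢ z<x))
    pc (trans pa (sym (ue-reversed y<x))) (trans pb (sym (ue-reversed z<x)))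

triangleView : IsGen Φ triangle a b c → In₃ g a b c → TriangleView a b c g
triangleView (tri-nnn z<y y<x) = triangleView-shape z<y y<x refl refl refl
triangleView (tri-npp z<y y<x) = triangleView-shape z<y y<x refl refl refl
triangleView (tri-pnp z<y y<x) = triangleView-shape z<y y<x refl refl refl
triangleView (tri-ppn z<y y<x) = triangleView-shape z<y y<x refl refl refl

data PairView (a b c g : Game n) : Set where
  at-half : (S : Split a b c g) (u w : Fin n) → g ≡ half u → w ≢ u →
            proj (rest₁ S) ≡ ue u w → rest₂ S ≡ half w → PairView a b c g
  at-edge : (S : Split a b c g) (u v : Fin n) → proj g ≡ uedge u v →
            rest₁ S ≡ half u → rest₂ S ≡ half v → PairView a b c g

pairView-shape : {a : Game n} → j < i → proj a ≡ uedge i j →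
                 In₃ g a (half i) (half j) → PairView a (half i) (half j) g
pairView-shape {j = j} {i = i} {a = a} j<i pa = view
  where
  edge≢half : ∀ {k} → a ≢ half k
  edge≢half e with trans (sym pa) (cong proj e)
  ... | ()
  abc : Distinct a (half i) (half j)
  abc = edge≢half , edge≢half , λ { refl → <⇒≢ j<i refl }
  view : In₃ g a (half i) (half j) → PairView a (half i) (half j) g
  view m@(inj₁ refl)        = at-edge (split abc m) i j pa refl refl
  view m@(inj₂ (inj₁ refl)) =
    at-half (split abc m) i j refl (<⇒≢ j<i) (trans pa (sym (ue-ordered j<i))) refl
  view m@(inj₂ (inj₂ refl)) =
    at-half (split abc m) j i refl (≢-sym (<⇒≢ j<i)) (trans pa (sym (ue-reversed j<i))) refl

pairView : IsGen Φ pair a b c → In₃ g a b c → PairView a b c g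
pairView (pair-n _ j<i) = pairView-shape j<i refl
pairView (pair-p _ j<i) = pairView-shape j<i refl

data CloverView (a b c g : Game n) : Set where
  at-loop : (S : Split a b c g) (u v : Fin n) → g ≡ loop u → v < u →
            rest₁ S ≡ neg u v → rest₂ S ≡ pos u v → CloverView a b c g
  at-edge : (S : Split a b c g) (u v : Fin n) → proj g ≡ uedge u v → v < u →
            proj (rest₁ S) ≡ uedge u v → rest₂ S ≡ loop u → CloverView a b c g

clover-distinct : Distinct (neg i j) (pos i j) (loop i)
clover-distinct = (λ ()) , (λ ()) , (λ ())

cloverView : IsGen Φ clover a b c → In₃ g a b c → CloverView a b c g
cloverView (clover _ j<i) m@(inj₁ refl)        = at-edge (split clover-distinct m) _ _ refl j<i refl refl
cloverView (clover _ j<i) m@(inj₂ (inj₁ refl)) = at-edge (split clover-distinct m) _ _ refl j<i refl refl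
cloverView (clover _ j<i) m@(inj₂ (inj₂ refl)) = at-loop (split clover-distinct m) _ _ refl j<i refl refl

edge-valid : proj h ≡ uedge i j → j < i → Valid Φ h
edge-valid {h = neg _ _} refl j<i = j<i
edge-valid {h = pos _ _} refl j<i = j<i

isGen-valid : {k : Kind} → IsGen Φ k a b c → In₃ h a b c → Valid Φ h
isGen-valid {k = triangle} t m = edge-valid (TriangleView.proj-g V) (TriangleView.v<u V)
  where V = triangleView t m
isGen-valid (pair-n _ j<i)   (inj₁ refl)        = j<i
isGen-valid (pair-n Φ≡B _)   (inj₂ (inj₁ refl)) = Φ≡B
isGen-valid (pair-n Φ≡B _)   (inj₂ (inj₂ refl)) = Φ≡B
isGen-valid (pair-p _ j<i)   (inj₁ refl)        = j<i
isGen-valid (pair-p Φ≡B _)   (inj₂ (inj₁ refl)) = Φ≡B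
isGen-valid (pair-p Φ≡B _)   (inj₂ (inj₂ refl)) = Φ≡B
isGen-valid (clover _ j<i)   (inj₁ refl)        = j<i
isGen-valid (clover _ j<i)   (inj₂ (inj₁ refl)) = j<i
isGen-valid (clover Φ≡C _)   (inj₂ (inj₂ refl)) = Φ≡C

∈G-valid : (G : GenCopy Φ T) → h ∈G G → Valid Φ h
∈G-valid G = isGen-valid (isGen G)

_∈G?_ : (h : Game n) (G : GenCopy Φ T) → Dec (h ∈G G)
h ∈G? G = (h ≟ᴳ ga G) ⊎-dec (h ≟ᴳ gb G) ⊎-dec (h ≟ᴳ gc G)

flips-differ⇔ : (G₁ G₂ : GenCopy Φ T) →
                IsFlip Φ T G₁ T₁ → IsFlip Φ T G₂ T₂ → Valid Φ h →
                T₁ h ≢ T₂ h ⇔ (h ∈G G₁ × ¬ h ∈G G₂ ⊎ ¬ h ∈G G₁ × h ∈G G₂)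
flips-differ⇔ {T₁ = T₁} {T₂ = T₂} {h = h} G₁ G₂ flip₁ flip₂ v = mk⇔ differ⇒ ⇒differ
  where
  flipped₁ = proj₁ (flip₁ h v)
  flipped₂ = proj₁ (flip₂ h v)
  kept₁ = proj₂ (flip₁ h v)
  kept₂ = proj₂ (flip₂ h v)

  differ⇒ : T₁ h ≢ T₂ h → h ∈G G₁ × ¬ h ∈G G₂ ⊎ ¬ h ∈G G₁ × h ∈G G₂
  differ⇒ ne with h ∈G? G₁ | h ∈G? G₂
  ... | yes m₁ | yes m₂ = ⊥-elim (ne (trans (flipped₁ m₁) (sym (flipped₂ m₂))))
  ... | yes m₁ | no  n₂ = inj₁ (m₁ , n₂)
  ... | no  n₁ | yes m₂ = inj₂ (n₁ , m₂)
  ... | no  n₁ | no  n₂ = ⊥-elim (ne (trans (kept₁ n₁) (sym (kept₂ n₂))))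

  ⇒differ : h ∈G G₁ × ¬ h ∈G G₂ ⊎ ¬ h ∈G G₁ × h ∈G G₂ → T₁ h ≢ T₂ h
  ⇒differ (inj₁ (m₁ , n₂)) e = not-¬ refl (trans (sym (kept₂ n₂)) (trans (sym e) (flipped₁ m₁)))
  ⇒differ (inj₂ (n₁ , m₂)) e = not-¬ refl (trans (sym (kept₁ n₁)) (trans e (flipped₂ m₂)))

module Difference {Φ : RootSys} {T T₁ T₂ : Tournament n} (G₁ G₂ : GenCopy Φ T)
  (flip₁ : IsFlip Φ T G₁ T₁) (flip₂ : IsFlip Φ T G₂ T₂)
  {g : Game n} (common : ∀ h → h ∈G G₁ → h ∈G G₂ → h ≡ g)
  (S₁ : Split (ga G₁) (gb G₁) (gc G₁) g) (S₂ : Split (ga G₂) (gb G₂) (gc G₂) g) where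

  InDiff⇔ : InDiff Φ T₁ T₂ h ⇔ h ∈ rests S₁ ++ rests S₂
  InDiff⇔ {h = h} = mk⇔ inDiff⇒ (⇒inDiff ∘ ∈-++⁻ (rests S₁))
    where
    inDiff⇒ : InDiff Φ T₁ T₂ h → h ∈ rests S₁ ++ rests S₂
    inDiff⇒ (v , ne) with to (flips-differ⇔ G₁ G₂ flip₁ flip₂ v) ne
    ... | inj₁ (m₁ , n₂) = ∈-++⁺ˡ (⇒∈-rests S₁ m₁ λ { refl → n₂ (self-∈ S₂) })
    ... | inj₂ (n₁ , m₂) = ∈-++⁺ʳ (rests S₁) (⇒∈-rests S₂ m₂ λ { refl → n₁ (self-∈ S₁) })

    ⇒inDiff : h ∈ rests S₁ ⊎ h ∈ rests S₂ → InDiff Φ T₁ T₂ h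
    ⇒inDiff (inj₁ x) with ∈-rests⇒ S₁ x
    ... | m₁ , h≢g = ∈G-valid G₁ m₁ , from (flips-differ⇔ G₁ G₂ flip₁ flip₂ (∈G-valid G₁ m₁))
                       (inj₁ (m₁ , λ m₂ → h≢g (common h m₁ m₂)))
    ⇒inDiff (inj₂ x) with ∈-rests⇒ S₂ x
    ... | m₂ , h≢g = ∈G-valid G₂ m₂ , from (flips-differ⇔ G₁ G₂ flip₁ flip₂ (∈G-valid G₂ m₂))
                       (inj₂ ((λ m₁ → h≢g (common h m₁ m₂)) , m₂))

  rests-disjoint : ¬ (h ∈ rests S₁ × h ∈ rests S₂)
  rests-disjoint (x₁ , x₂) with ∈-rests⇒ S₁ x₁ | ∈-rests⇒ S₂ x₂
  ... | m₁ , h≢g | m₂ , _ = h≢g (common _ m₁ m₂)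

  diff-unique : Unique (rests S₁ ++ rests S₂)
  diff-unique = ++⁺ (rests-unique S₁) (rests-unique S₂) rests-disjoint

  diff-projIs : {e₁ e₂ e₃ e₄ : UEdge n} {S : List (UEdge n)} →
                proj (rest₁ S₁) ≡ e₁ → proj (rest₂ S₁) ≡ e₂ →
                proj (rest₁ S₂) ≡ e₃ → proj (rest₂ S₂) ≡ e₄ →
                e₁ ∷ e₂ ∷ e₃ ∷ e₄ ∷ [] ↭ S → ProjIs (InDiff Φ T₁ T₂) S
  diff-projIs refl refl refl refl perm =
    rests S₁ ++ rests S₂ , diff-unique , (λ h → from InDiff⇔ , to InDiff⇔) , perm

_touches_ : {T : Tournament n} → GenCopy Φ T → Fin n → Set
_touches_ {n = n} G t = Σ (Game n) λ h → h ∈G G × Incident h t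

touches-⊎⇔ : (G₁ G₂ : GenCopy Φ T) →
             Σ (Game n) (λ h → (h ∈G G₁ ⊎ h ∈G G₂) × Incident h t) ⇔ (G₁ touches t ⊎ G₂ touches t)
touches-⊎⇔ G₁ G₂ =
  mk⇔ (λ { (h , inj₁ m , i) → inj₁ (h , m , i) ; (h , inj₂ m , i) → inj₂ (h , m , i) })
      [ (λ (h , m , i) → h , inj₁ m , i) , (λ (h , m , i) → h , inj₂ m , i) ]

spans-length : (G₁ G₂ : GenCopy Φ T) {k : ℕ} {vs : List (Fin n)} →
               SpansVertices k G₁ G₂ → Unique vs →
               (∀ {t} → (G₁ touches t ⊎ G₂ touches t) ⇔ t ∈ vs) → k ≡ length vs
spans-length G₁ G₂ {vs = vs} (Ls , refl , unique-Ls , spanned) unique-vs touches⇔ =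
  ↭-length (∼bag⇒↭ (unique∧set⇒bag unique-Ls unique-vs same-vertices))
  where
  same-vertices : ∀ {t} → t ∈ Ls ⇔ t ∈ vs
  same-vertices {t} = mk⇔ (to touches⇔ ∘ to (touches-⊎⇔ G₁ G₂) ∘ proj₁ (spanned t))
                          (proj₂ (spanned t) ∘ from (touches-⊎⇔ G₁ G₂) ∘ from touches⇔)

equal-vertices-span : (G₁ G₂ : GenCopy Φ T) {k : ℕ} {vs : List (Fin n)} →
                      (∀ {t} → G₁ touches t ⇔ t ∈ vs) → (∀ {t} → G₂ touches t ⇔ t ∈ vs) →
                      Unique vs → SpansVertices k G₁ G₂ → k ≡ length vs
equal-vertices-span G₁ G₂ touches₁ touches₂ unique-vs span =
  spans-length G₁ G₂ span unique-vs (mk⇔ [ to touches₁ , to touches₂ ]′ (inj₁ ∘ from touches₁))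

distinct-apexes-span : {u v w w′ : Fin n} (G₁ G₂ : GenCopy Φ T) {k : ℕ} →
                       (∀ {t} → G₁ touches t ⇔ t ∈ u ∷ v ∷ w ∷ []) →
                       (∀ {t} → G₂ touches t ⇔ t ∈ u ∷ v ∷ w′ ∷ []) →
                       Unique (u ∷ v ∷ w ∷ w′ ∷ []) → SpansVertices k G₁ G₂ → k ≡ 4
distinct-apexes-span {u = u} {v} {w} {w′} G₁ G₂ touches₁ touches₂ unique-vs span =
  spans-length G₁ G₂ span unique-vs
    (mk⇔ [ ∈-++⁺ˡ ∘ to touches₁ , extend ∘ to touches₂ ]′ (restrict ∘ ∈-++⁻ (u ∷ v ∷ w ∷ [])))
  where
  extend : ∀ {t} → t ∈ u ∷ v ∷ w′ ∷ [] → t ∈ u ∷ v ∷ w ∷ w′ ∷ []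
  extend (here e)                 = here e
  extend (there (here e))         = there (here e)
  extend (there (there (here e))) = there (there (there (here e)))
  restrict : ∀ {t} → t ∈ u ∷ v ∷ w ∷ [] ⊎ t ∈ w′ ∷ [] → G₁ touches t ⊎ G₂ touches t
  restrict (inj₁ x)        = inj₁ (from touches₁ x)
  restrict (inj₂ (here e)) = inj₂ (from touches₂ (there (there (here e))))

IsGenOf : Kind → GenCopy Φ T → Set
IsGenOf {Φ = Φ} k G = IsGen Φ k (ga G) (gb G) (gc G)

isGenOf : {k : Kind} (G : GenCopy Φ T) → kind G ≡ k → IsGenOf k G
isGenOf G refl = isGen G

module TwoFlips {Φ : RootSys} {T T₁ T₂ : Tournament n} (G₁ G₂ : GenCopy Φ T)
             (flip₁ : IsFlip Φ T G₁ T₁) (flip₂ : IsFlip Φ T G₂ T₂) where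

  triangle-triangle : Adjacent G₁ G₂ → IsGenOf triangle G₁ → IsGenOf triangle G₂ →
                      (SpansVertices 4 G₁ G₂ → Square (InDiff Φ T₁ T₂))
                    × (SpansVertices 3 G₁ G₂ → Tent (InDiff Φ T₁ T₂))
  triangle-triangle (g , g∈₁ , g∈₂ , common) t₁ t₂ with triangleView t₁ g∈₁ | triangleView t₂ g∈₂
  ... | V₁@(triangleAt S₁ u v w _ _ _ pg p₁ q₁) | V₂@(triangleAt S₂ _ _ w′ _ _ _ pg′ p₂ q₂)
    with same-uedge refl pg pg′
  ... | refl , refl with w ≟ᶠ w′ | distinct-uvw V₁ | distinct-uvw V₂
  ...   | yes refl | u≢v , u≢w , v≢w | _ = no-square , λ _ → tent
    where
    open Difference G₁ G₂ flip₁ flip₂ common S₁ S₂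
    no-square : SpansVertices 4 G₁ G₂ → Square (InDiff Φ T₁ T₂)
    no-square span = contradiction (equal-vertices-span G₁ G₂ (vertices⇔ V₁) (vertices⇔ V₂)
                                      ((u≢v ∷ u≢w ∷ []) ∷ (v≢w ∷ []) ∷ [] ∷ []) span) λ ()
    tent : Tent (InDiff Φ T₁ T₂)
    tent = w , u , v , ≢-sym u≢w , ≢-sym v≢w , u≢v ,
      diff-projIs (trans p₁ (ue-comm u w)) (trans q₁ (ue-comm v w))
                  (trans p₂ (ue-comm u w)) (trans q₂ (ue-comm v w))
                  (↭-prep _ (↭-swap _ _ ↭-refl))
  ...   | no w≢w′ | u≢v , u≢w , v≢w | _ , u≢w′ , v≢w′ = (λ _ → square) , no-tent
    where
    open Difference G₁ G₂ flip₁ flip₂ common S₁ S₂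
    square : Square (InDiff Φ T₁ T₂)
    square = u , w , v , w′ , u≢w , u≢v , u≢w′ , ≢-sym v≢w , w≢w′ , v≢w′ ,
      diff-projIs p₁ (trans q₁ (ue-comm v w)) (trans p₂ (ue-comm u w′)) q₂
                  (↭-prep _ (↭-prep _ (↭-swap _ _ ↭-refl)))
    no-tent : SpansVertices 3 G₁ G₂ → Tent (InDiff Φ T₁ T₂)
    no-tent span = contradiction (distinct-apexes-span G₁ G₂ (vertices⇔ V₁) (vertices⇔ V₂)
      ((u≢v ∷ u≢w ∷ u≢w′ ∷ []) ∷ (v≢w ∷ v≢w′ ∷ []) ∷ (w≢w′ ∷ []) ∷ [] ∷ []) span) λ ()

  pair-pair : Adjacent G₁ G₂ → IsGenOf pair G₁ → IsGenOf pair G₂ → Fork (InDiff Φ T₁ T₂)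
  pair-pair (g , g∈₁ , g∈₂ , common) p₁ p₂ with pairView p₁ g∈₁ | pairView p₂ g∈₂
  ... | at-half S₁ u w refl w≢u e₁ r₁ | at-half S₂ _ w′ refl w′≢u e₂ r₂ =
    u , w , w′ , ≢-sym w≢u , ≢-sym w′≢u , w≢w′ ,
    diff-projIs e₁ (cong proj r₁) e₂ (cong proj r₂) (↭-prep _ (↭-swap _ _ ↭-refl))
    where
    open Difference G₁ G₂ flip₁ flip₂ common S₁ S₂
    w≢w′ : w ≢ w′
    w≢w′ w≡w′ =
      rests-disjoint (there (here (sym r₁)) , there (here (trans (cong half w≡w′) (sym r₂))))
  ... | at-half _ _ _ refl _ _ _ | at-edge _ _ _ () _ _
  ... | at-edge _ _ _ () _ _ | at-half _ _ _ refl _ _ _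
  ... | at-edge S₁ u v pg r₁ _ | at-edge S₂ _ _ pg′ r₂ _ with same-uedge refl pg pg′
  ...   | refl , refl = ⊥-elim (rests-disjoint (here (sym r₁) , here (sym r₂)))
    where open Difference G₁ G₂ flip₁ flip₂ common S₁ S₂

  pair-triangle : Adjacent G₁ G₂ → IsGenOf pair G₁ → IsGenOf triangle G₂ → Fork (InDiff Φ T₁ T₂)
  pair-triangle (g , g∈₁ , g∈₂ , common) p t with pairView p g∈₁ | triangleView t g∈₂
  ... | at-half _ _ _ refl _ _ _ | triangleAt _ _ _ _ _ _ _ () _ _
  ... | at-edge S₁ u v pg r₁ r₂ | triangleAt S₂ _ _ w v<u w≢u w≢v pg′ p₂ q₂
    with same-uedge refl pg pg′
  ...   | refl , refl = w , u , v , w≢u , w≢v , ≢-sym (<⇒≢ v<u) ,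
    diff-projIs (cong proj r₁) (cong proj r₂) (trans p₂ (ue-comm u w)) (trans q₂ (ue-comm v w))
      (++-comm (uhalf u ∷ uhalf v ∷ []) _)
    where open Difference G₁ G₂ flip₁ flip₂ common S₁ S₂

  clover-clover : Adjacent G₁ G₂ → IsGenOf clover G₁ → IsGenOf clover G₂ → Tent (InDiff Φ T₁ T₂)
  clover-clover (g , g∈₁ , g∈₂ , common) c₁ c₂ with cloverView c₁ g∈₁ | cloverView c₂ g∈₂
  ... | at-loop S₁ u v refl v<u r₁ r₂ | at-loop S₂ _ v′ refl v′<u r₁′ r₂′ =
    u , v , v′ , ≢-sym (<⇒≢ v<u) , ≢-sym (<⇒≢ v′<u) , v≢v′ ,
    diff-projIs (trans (cong proj r₁) uv) (trans (cong proj r₂) uv)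
                (trans (cong proj r₁′) uv′) (trans (cong proj r₂′) uv′) ↭-refl
    where
    open Difference G₁ G₂ flip₁ flip₂ common S₁ S₂
    uv  = sym (ue-ordered v<u)
    uv′ = sym (ue-ordered v′<u)
    v≢v′ : v ≢ v′
    v≢v′ v≡v′ = rests-disjoint (here (sym r₁) , here (trans (cong (neg u) v≡v′) (sym r₁′)))
  ... | at-loop _ _ _ refl _ _ _ | at-edge _ _ _ () _ _ _
  ... | at-edge _ _ _ () _ _ _ | at-loop _ _ _ refl _ _ _
  ... | at-edge S₁ u v pg _ _ r₂ | at-edge S₂ _ _ pg′ _ _ r₂′ with same-uedge refl pg pg′
  ...   | refl , refl = ⊥-elim (rests-disjoint (there (here (sym r₂)) , there (here (sym r₂′))))
    where open Difference G₁ G₂ flip₁ flip₂ common S₁ S₂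

  clover-triangle : Adjacent G₁ G₂ → IsGenOf clover G₁ → IsGenOf triangle G₂ → Hanger (InDiff Φ T₁ T₂)
  clover-triangle (g , g∈₁ , g∈₂ , common) c t with cloverView c g∈₁ | triangleView t g∈₂
  ... | at-loop _ _ _ refl _ _ _ | triangleAt _ _ _ _ _ _ _ () _ _
  ... | at-edge S₁ u v pg v<u p₁ r₂ | triangleAt S₂ _ _ w _ w≢u w≢v pg′ p₂ q₂
    with same-uedge refl pg pg′
  ...   | refl , refl = u , v , w , ≢-sym (<⇒≢ v<u) , ≢-sym w≢u , ≢-sym w≢v ,
    diff-projIs (trans p₁ (sym (ue-ordered v<u))) (cong proj r₂) p₂ q₂
      (↭-prep _ (↭-reverse (ue v w ∷ ue u w ∷ uloop u ∷ [])))
    where open Difference G₁ G₂ flip₁ flip₂ common S₁ S₂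

lemma16 : (Φ : RootSys) (n : ℕ) (T12 T1 T2 : Tournament n)
          (G1 G2 : GenCopy Φ T12) →
          IsFlip Φ T12 G1 T1 → IsFlip Φ T12 G2 T2 → Adjacent G1 G2 →
          ((kind G1 ≡ triangle → kind G2 ≡ triangle →
              (SpansVertices 4 G1 G2 → Square (InDiff Φ T1 T2))
            × (SpansVertices 3 G1 G2 → Tent (InDiff Φ T1 T2)))
          × (kind G1 ≡ clover → kind G2 ≡ clover → Tent (InDiff Φ T1 T2))
          × (kind G1 ≡ pair → (kind G2 ≡ pair ⊎ kind G2 ≡ triangle) →
              Fork (InDiff Φ T1 T2))
          × (kind G1 ≡ clover → kind G2 ≡ triangle → Hanger (InDiff Φ T1 T2)))
lemma16 Φ n T12 T1 T2 G1 G2 flip₁ flip₂ adjacent =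
    (λ k₁ k₂ → triangle-triangle adjacent (isGenOf G1 k₁) (isGenOf G2 k₂))
  , (λ k₁ k₂ → clover-clover adjacent (isGenOf G1 k₁) (isGenOf G2 k₂))
  , (λ { k₁ (inj₁ k₂) → pair-pair adjacent (isGenOf G1 k₁) (isGenOf G2 k₂)
       ; k₁ (inj₂ k₂) → pair-triangle adjacent (isGenOf G1 k₁) (isGenOf G2 k₂) })
  , (λ k₁ k₂ → clover-triangle adjacent (isGenOf G1 k₁) (isGenOf G2 k₂))
  where open TwoFlips G1 G2 flip₁ flip₂
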